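{- Let $a_1,\dots,a_d\in\mathbb Z$ with $s:=\sum_{i=1}^d a_i$ even. Let $(x_n)_{n\ge1}$ be a real sequence satisfying $x_n=a_1x_{n-1}+a_2x_{n-2}+\dots+a_dx_{n-d}$ for all $n>d$, and suppose $x_i=\frac{s-2}{2s-2}$ for $i=1,\dots,d$. Then $(x_n)$ is periodic modulo $1$ with period of length $1$, i.e. $\{x_{n+1}\}=\{x_n\}$ for all $n\ge1$.
   Context: $\{x\}$ denotes the fractional part of $x$. A sequence $(x_n)$ is periodic modulo 1 with period length $t$ if $\{x_n\}=\{x_{n+t}\}$ for all $n\in\mathbb N$.
   Formalization: The sequence $(x_n)$ takes rational values instead of real values. -}

module Defs where

open import Data.Nat using (ℕ; zero; suc)
open import Data.Integer as ℤ using (ℤ)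
open import Data.Rational as ℚ using (ℚ; 0ℚ; floor; _-_; _÷_; _/_)
open import Data.Rational.Properties using (_≟_)
open import Relation.Nullary using (yes; no)

sumℤ : ℕ → (ℕ → ℤ) → ℤ
sumℤ zero    f = ℤ.0ℤ
sumℤ (suc k) f = sumℤ k f ℤ.+ f (suc k)

sumℚ : ℕ → (ℕ → ℚ) → ℚ
sumℚ zero    f = 0ℚ
sumℚ (suc k) f = sumℚ k f ℚ.+ f (suc k)

-- total division on ℚ (value 0 when dividing by 0; only used with nonzero divisors)
divℚ : ℚ → ℚ → ℚ
divℚ p q with q ≟ 0ℚ
... | yes _  = 0ℚ
... | no q≢0 = _÷_ p q {{ℚ.≢-nonZero q≢0}}

frac : ℚ → ℚ
frac x = x - (floor x / 1)

{-# OPTIONS --safe #-}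
-- Write s = 2t and c = (s - 2)/(2s - 2). Then s·(s - 2) = (s - 2) + (t - 1)(2s - 2),
-- so s·c = c + (t - 1) and c is fixed by multiplication by s modulo 1. The recurrence
-- is ℤ-linear with coefficient sum s, so by strong induction every x_n is congruent
-- to c modulo 1: x_n ≡ Σ a_i x_{n-i} ≡ Σ a_i c = s·c ≡ c.
module Submission where

open import Defs
open import Data.Nat using (ℕ; zero; suc; z≤n; s≤s; _≤_; _<_; _<?_; _∸_)
open import Data.Integer as ℤ using (ℤ; 0ℤ; 1ℤ)
open import Data.Integer.Divisibility using (_∣_)
open import Data.Rational as ℚ using (ℚ)
import Data.Nat.Properties as ℕₚ
open import Data.Nat.Induction using (<-rec)
open import Data.Nat.Coprimality as Coprimality using (1-coprimeTo)
import Data.Integer.Properties as ℤₚ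
open import Data.Integer.DivMod using ([n/d]*d≤n; div-pos-is-/ℕ; n<s[n/ℕd]*d)
open import Data.Integer.Divisibility.Signed using (divides; ∣ᵤ⇒∣)
open import Data.Integer.Tactic.RingSolver using (solve-∀)
open import Data.Rational using (mkℚ; ↥_; ↧_; ↧ₙ_; 0ℚ; _+_; _*_; _-_; 1/_; *≤*; *<*; floor)
open import Data.Rational.Properties as ℚₚ using (↥p/↧p≡p)
open import Data.Rational.Solver using (module +-*-Solver)
open import Relation.Nullary using (yes; no)
open import Function using (_∘_)
open import Relation.Binary.PropositionalEquality using (_≡_; refl; sym; trans; cong; cong₂; subst; subst₂; module ≡-Reasoning)

fromℤ : ℤ → ℚ
fromℤ k = k ℚ./ 1

fromℤ≡mkℚ : ∀ k → fromℤ k ≡ mkℚ k 0 (Coprimality.sym (1-coprimeTo ℤ.∣ k ∣))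
fromℤ≡mkℚ k = ↥p/↧p≡p (mkℚ k 0 _)

↥-fromℤ : ∀ k → ↥ fromℤ k ≡ k
↥-fromℤ k = cong ↥_ (fromℤ≡mkℚ k)

↧-fromℤ : ∀ k → ↧ fromℤ k ≡ 1ℤ
↧-fromℤ k = cong ↧_ (fromℤ≡mkℚ k)

fromℤ-homo-+ : ∀ i j → fromℤ (i ℤ.+ j) ≡ fromℤ i + fromℤ j
fromℤ-homo-+ i j = begin
  fromℤ (i ℤ.+ j)                ≡⟨ cong₂ (λ u v → fromℤ (u ℤ.+ v)) (ℤₚ.*-identityʳ i) (ℤₚ.*-identityʳ j) ⟨
  -- the sum of two rationals with denominator 1 computes to this
  fromℤ (i ℤ.* 1ℤ ℤ.+ j ℤ.* 1ℤ)  ≡⟨ cong₂ _+_ (fromℤ≡mkℚ i) (fromℤ≡mkℚ j) ⟨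
  fromℤ i + fromℤ j              ∎
  where open ≡-Reasoning

fromℤ-homo-* : ∀ i j → fromℤ (i ℤ.* j) ≡ fromℤ i * fromℤ j
fromℤ-homo-* i j = sym (cong₂ _*_ (fromℤ≡mkℚ i) (fromℤ≡mkℚ j))

*-↧-fromℤ : ∀ i k → i ℤ.* ↧ fromℤ k ≡ i
*-↧-fromℤ i k = trans (cong (i ℤ.*_) (↧-fromℤ k)) (ℤₚ.*-identityʳ i)

fromℤ-≤ : ∀ {k p} → k ℤ.* ↧ p ℤ.≤ ↥ p → fromℤ k ℚ.≤ p
fromℤ-≤ {k} {p} = *≤* ∘ subst₂ ℤ._≤_ (cong (ℤ._* ↧ p) (sym (↥-fromℤ k))) (sym (*-↧-fromℤ (↥ p) k))

<-fromℤ : ∀ {k p} → ↥ p ℤ.< k ℤ.* ↧ p → p ℚ.< fromℤ k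
<-fromℤ {k} {p} = *<* ∘ subst₂ ℤ._<_ (sym (*-↧-fromℤ (↥ p) k)) (cong (ℤ._* ↧ p) (sym (↥-fromℤ k)))

fromℤ-cancel-< : ∀ {i j} → fromℤ i ℚ.< fromℤ j → i ℤ.< j
fromℤ-cancel-< {i} {j} (*<* lt) = subst₂ ℤ._<_ (↥*↧ i j) (↥*↧ j i) lt
  where
  ↥*↧ : ∀ u v → ↥ fromℤ u ℤ.* ↧ fromℤ v ≡ u
  ↥*↧ u v = trans (cong (ℤ._* ↧ fromℤ v) (↥-fromℤ u)) (*-↧-fromℤ u v)

<-suc⇒≤ : ∀ {i j} → i ℤ.< ℤ.suc j → i ℤ.≤ j
<-suc⇒≤ {i} {j} i<1+j = subst (i ℤ.≤_) (ℤₚ.pred-suc j) (ℤₚ.i<j⇒i≤pred[j] i<1+j)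

floor-≤ : ∀ p → fromℤ (floor p) ℚ.≤ p
floor-≤ p@record{} = fromℤ-≤ {floor p} {p} ([n/d]*d≤n (↥ p) (↧ p))

<-suc-floor : ∀ p → p ℚ.< fromℤ (ℤ.suc (floor p))
<-suc-floor p@record{} = <-fromℤ {ℤ.suc (floor p)} {p}
  (subst (λ f → ↥ p ℤ.< ℤ.suc f ℤ.* ↧ p) (sym (div-pos-is-/ℕ (↥ p) (↧ₙ p))) (n<s[n/ℕd]*d (↥ p) (↧ₙ p)))

floor-unique : ∀ {m p} → fromℤ m ℚ.≤ p → p ℚ.< fromℤ (ℤ.suc m) → floor p ≡ m
floor-unique {m} {p} m≤p p<1+m = ℤₚ.≤-antisym
  (<-suc⇒≤ (fromℤ-cancel-< (ℚₚ.≤-<-trans (floor-≤ p) p<1+m)))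
  (<-suc⇒≤ (fromℤ-cancel-< (ℚₚ.≤-<-trans m≤p (<-suc-floor p))))

floor-+-fromℤ : ∀ p k → floor (p + fromℤ k) ≡ floor p ℤ.+ k
floor-+-fromℤ p k = floor-unique
  (subst (ℚ._≤ p + fromℤ k) (sym (fromℤ-homo-+ (floor p) k)) (ℚₚ.+-monoˡ-≤ (fromℤ k) (floor-≤ p)))
  (subst (p + fromℤ k ℚ.<_) suc-floor+k (ℚₚ.+-monoˡ-< (fromℤ k) (<-suc-floor p)))
  where
  suc-floor+k : fromℤ (ℤ.suc (floor p)) + fromℤ k ≡ fromℤ (ℤ.suc (floor p ℤ.+ k))
  suc-floor+k = trans (sym (fromℤ-homo-+ (ℤ.suc (floor p)) k)) (cong fromℤ (ℤₚ.+-assoc 1ℤ (floor p) k))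

frac-+-fromℤ : ∀ p k → frac (p + fromℤ k) ≡ frac p
frac-+-fromℤ p k = begin
  (p + K) - fromℤ (floor (p + K))        ≡⟨ cong (λ f → (p + K) - fromℤ f) (floor-+-fromℤ p k) ⟩
  (p + K) - fromℤ (floor p ℤ.+ k)        ≡⟨ cong ((p + K) -_) (fromℤ-homo-+ (floor p) k) ⟩
  (p + K) - (fromℤ (floor p) + K)        ≡⟨ solve 3 (λ p K F → (p :+ K) :- (F :+ K) := p :- F) refl p K (fromℤ (floor p)) ⟩
  p - fromℤ (floor p)                    ∎
  where
  open ≡-Reasoning
  open +-*-Solver
  K = fromℤ k

infix 4 _≡_mod1

data _≡_mod1 (p q : ℚ) : Set where
  shift : (k : ℤ) → p ≡ q + fromℤ k → p ≡ q mod1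

≡⇒≡-mod1 : ∀ {p q} → p ≡ q → p ≡ q mod1
≡⇒≡-mod1 {p} refl = shift 0ℤ (sym (ℚₚ.+-identityʳ p))

≡-mod1-trans : ∀ {p q r} → p ≡ q mod1 → q ≡ r mod1 → p ≡ r mod1
≡-mod1-trans {r = r} (shift k refl) (shift l refl) = shift (l ℤ.+ k) (begin
  (r + fromℤ l) + fromℤ k   ≡⟨ ℚₚ.+-assoc r (fromℤ l) (fromℤ k) ⟩
  r + (fromℤ l + fromℤ k)   ≡⟨ cong (r +_) (fromℤ-homo-+ l k) ⟨
  r + fromℤ (l ℤ.+ k)       ∎)
  where open ≡-Reasoning

+-cong-mod1 : ∀ {p q r s} → p ≡ q mod1 → r ≡ s mod1 → p + r ≡ q + s mod1
+-cong-mod1 {q = q} {s = s} (shift k refl) (shift l refl) = shift (k ℤ.+ l) (begin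
  (q + fromℤ k) + (s + fromℤ l)   ≡⟨ solve 4 (λ q K s L → (q :+ K) :+ (s :+ L) := (q :+ s) :+ (K :+ L)) refl q (fromℤ k) s (fromℤ l) ⟩
  (q + s) + (fromℤ k + fromℤ l)   ≡⟨ cong ((q + s) +_) (fromℤ-homo-+ k l) ⟨
  (q + s) + fromℤ (k ℤ.+ l)       ∎)
  where
  open ≡-Reasoning
  open +-*-Solver

*-congˡ-mod1 : ∀ a {p q} → p ≡ q mod1 → fromℤ a * p ≡ fromℤ a * q mod1
*-congˡ-mod1 a {q = q} (shift k refl) = shift (a ℤ.* k) (begin
  fromℤ a * (q + fromℤ k)          ≡⟨ ℚₚ.*-distribˡ-+ (fromℤ a) q (fromℤ k) ⟩
  fromℤ a * q + fromℤ a * fromℤ k  ≡⟨ cong (fromℤ a * q +_) (fromℤ-homo-* a k) ⟨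
  fromℤ a * q + fromℤ (a ℤ.* k)    ∎)
  where open ≡-Reasoning

frac-cong-mod1 : ∀ {p q} → p ≡ q mod1 → frac p ≡ frac q
frac-cong-mod1 {q = q} (shift k refl) = frac-+-fromℤ q k

sumℚ-cong-mod1 : ∀ d {f g : ℕ → ℚ} → (∀ i → 1 ≤ i → i ≤ d → f i ≡ g i mod1) → sumℚ d f ≡ sumℚ d g mod1
sumℚ-cong-mod1 zero    f≡g = ≡⇒≡-mod1 refl
sumℚ-cong-mod1 (suc d) f≡g = +-cong-mod1
  (sumℚ-cong-mod1 d (λ i 1≤i i≤d → f≡g i 1≤i (ℕₚ.m≤n⇒m≤1+n i≤d)))
  (f≡g (suc d) (s≤s z≤n) ℕₚ.≤-refl)

sumℚ-fromℤ-*ʳ : ∀ d (a : ℕ → ℤ) c → sumℚ d (λ i → fromℤ (a i) * c) ≡ fromℤ (sumℤ d a) * c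
sumℚ-fromℤ-*ʳ zero    a c = sym (ℚₚ.*-zeroˡ c)
sumℚ-fromℤ-*ʳ (suc d) a c = begin
  sumℚ d (λ i → fromℤ (a i) * c) + fromℤ (a (suc d)) * c   ≡⟨ cong (_+ fromℤ (a (suc d)) * c) (sumℚ-fromℤ-*ʳ d a c) ⟩
  fromℤ (sumℤ d a) * c + fromℤ (a (suc d)) * c             ≡⟨ ℚₚ.*-distribʳ-+ c (fromℤ (sumℤ d a)) (fromℤ (a (suc d))) ⟨
  (fromℤ (sumℤ d a) + fromℤ (a (suc d))) * c               ≡⟨ cong (_* c) (fromℤ-homo-+ (sumℤ d a) (a (suc d))) ⟨
  fromℤ (sumℤ d a ℤ.+ a (suc d)) * c                       ∎
  where open ≡-Reasoning

recurrence-≡-mod1 : ∀ d (a : ℕ → ℤ) (x : ℕ → ℚ) c →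
  fromℤ (sumℤ d a) * c ≡ c mod1 →
  (∀ n → d < n → x n ≡ sumℚ d (λ i → fromℤ (a i) * x (n ∸ i))) →
  (∀ i → 1 ≤ i → i ≤ d → x i ≡ c mod1) →
  ∀ n → 1 ≤ n → x n ≡ c mod1
recurrence-≡-mod1 d a x c sc≡c recurrence initial = <-rec (λ n → 1 ≤ n → x n ≡ c mod1) step
  where
  step : ∀ n → (∀ {m} → m < n → 1 ≤ m → x m ≡ c mod1) → 1 ≤ n → x n ≡ c mod1
  step n earlier 1≤n with d <? n
  ... | no  d≮n = initial n 1≤n (ℕₚ.≮⇒≥ d≮n)
  ... | yes d<n = ≡-mod1-trans (≡⇒≡-mod1 (recurrence n d<n))
                  (≡-mod1-trans (sumℚ-cong-mod1 d earlier-terms)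
                  (≡-mod1-trans (≡⇒≡-mod1 (sumℚ-fromℤ-*ʳ d a c)) sc≡c))
    where
    earlier-terms : ∀ i → 1 ≤ i → i ≤ d → fromℤ (a i) * x (n ∸ i) ≡ fromℤ (a i) * c mod1
    earlier-terms i 1≤i i≤d = *-congˡ-mod1 (a i)
      (earlier (ℕₚ.∸-monoʳ-< 1≤i (ℕₚ.<⇒≤ i<n)) (ℕₚ.m<n⇒0<n∸m i<n))
      where i<n = ℕₚ.≤-<-trans i≤d d<n

divℚ-fixed-mod1 : ∀ s n m t → s ℤ.* n ≡ n ℤ.+ t ℤ.* m →
  fromℤ s * divℚ (fromℤ n) (fromℤ m) ≡ divℚ (fromℤ n) (fromℤ m) mod1
divℚ-fixed-mod1 s n m t sn≡n+tm with fromℤ m ℚₚ.≟ 0ℚ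
-- divℚ returns 0 for a zero divisor, and 0 is trivially fixed
... | yes _   = ≡⇒≡-mod1 (ℚₚ.*-zeroʳ (fromℤ s))
... | no  m≢0 = shift t (begin
  S * (N * 1/ M)             ≡⟨ ℚₚ.*-assoc S N (1/ M) ⟨
  (S * N) * 1/ M             ≡⟨ cong (_* 1/ M) S*N≡N+T*M ⟩
  (N + T * M) * 1/ M         ≡⟨ solve 4 (λ N T M R → (N :+ T :* M) :* R := N :* R :+ T :* (M :* R)) refl N T M (1/ M) ⟩
  N * 1/ M + T * (M * 1/ M)  ≡⟨ cong (λ u → N * 1/ M + T * u) (ℚₚ.*-inverseʳ M) ⟩
  N * 1/ M + T * ℚ.1ℚ        ≡⟨ cong (N * 1/ M +_) (ℚₚ.*-identityʳ T) ⟩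
  N * 1/ M + T               ∎)
  where
  instance _ = ℚ.≢-nonZero m≢0
  open ≡-Reasoning
  open +-*-Solver
  S = fromℤ s
  N = fromℤ n
  M = fromℤ m
  T = fromℤ t
  S*N≡N+T*M : S * N ≡ N + T * M
  S*N≡N+T*M = begin
    S * N                  ≡⟨ fromℤ-homo-* s n ⟨
    fromℤ (s ℤ.* n)        ≡⟨ cong fromℤ sn≡n+tm ⟩
    fromℤ (n ℤ.+ t ℤ.* m)  ≡⟨ fromℤ-homo-+ n (t ℤ.* m) ⟩
    N + fromℤ (t ℤ.* m)    ≡⟨ cong (N +_) (fromℤ-homo-* t m) ⟩
    N + T * M              ∎

seed : ℤ → ℚ
seed s = divℚ (fromℤ (s ℤ.- ℤ.+ 2)) (fromℤ (ℤ.+ 2 ℤ.* s ℤ.- ℤ.+ 2))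

seed-fixed-mod1 : ∀ s → ℤ.+ 2 ∣ s → fromℤ s * seed s ≡ seed s mod1
seed-fixed-mod1 s 2∣s with ∣ᵤ⇒∣ {ℤ.+ 2} {s} 2∣s
... | divides t refl = divℚ-fixed-mod1 (t ℤ.* ℤ.+ 2) _ _ (t ℤ.- 1ℤ) (s[s-2]≡s-2+[t-1][2s-2] t)
  where
  s[s-2]≡s-2+[t-1][2s-2] : ∀ t → let s = t ℤ.* ℤ.+ 2 in
    s ℤ.* (s ℤ.- ℤ.+ 2) ≡ (s ℤ.- ℤ.+ 2) ℤ.+ (t ℤ.- 1ℤ) ℤ.* (ℤ.+ 2 ℤ.* s ℤ.- ℤ.+ 2)
  s[s-2]≡s-2+[t-1][2s-2] = solve-∀

lemma3p2 : (d : ℕ) (a : ℕ → ℤ) (x : ℕ → ℚ) →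
    ℤ.+ 2 ∣ sumℤ d a →
    (∀ n → d < n → x n ≡ sumℚ d (λ i → ℚ._*_ (a i ℚ./ 1) (x (n ∸ i)))) →
    (∀ i → 1 ≤ i → i ≤ d →
      x i ≡ divℚ ((sumℤ d a ℤ.- ℤ.+ 2) ℚ./ 1) ((ℤ.+ 2 ℤ.* sumℤ d a ℤ.- ℤ.+ 2) ℚ./ 1)) →
    ∀ n → 1 ≤ n → frac (x (suc n)) ≡ frac (x n)
lemma3p2 d a x 2∣s recurrence initial n 1≤n = begin
  frac (x (suc n))        ≡⟨ frac-cong-mod1 (x≡seed (suc n) (s≤s z≤n)) ⟩
  frac (seed (sumℤ d a))  ≡⟨ frac-cong-mod1 (x≡seed n 1≤n) ⟨
  frac (x n)              ∎
  where
  open ≡-Reasoning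
  x≡seed : ∀ n → 1 ≤ n → x n ≡ seed (sumℤ d a) mod1
  x≡seed = recurrence-≡-mod1 d a x (seed (sumℤ d a)) (seed-fixed-mod1 (sumℤ d a) 2∣s) recurrence
          (λ i 1≤i i≤d → ≡⇒≡-mod1 (initial i 1≤i i≤d))
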